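{- Any varying agent-domain full monotonic neighborhood world frame that validates $p\to\exists\mathrm{v}\,\Box_\mathrm{v}p$ also validates $\exists\mathrm{v}\,O(\mathrm{v})$.
   Context: Fix a nonempty index set $I$, a countably infinite set of propositional variables, and a countably infinite set $\mathsf{Var}$ of (agent) variables. The language $\mathcal{TML}_{GO}$: $\varphi::=p\mid\neg\varphi\mid(\varphi\wedge\varphi)\mid\Box_\mathrm{v}\varphi\mid\forall\mathrm{v}\varphi\mid G(\mathrm{v})\mid O(\mathrm{v})$ with $\mathrm{v}\in\mathsf{Var}$; $\to$ is defined classically and $\exists\mathrm{v}=\neg\forall\mathrm{v}\neg$. A varying agent-domain full monotonic neighborhood world frame is $(W,\{N_i\}_{i\in I},\mathrm{G})$ with $W$ nonempty, $N_i:W\to\wp(\wp(W))$ such that each $N_i(w)$ is closed under supersets, and $\mathrm{G}:W\to\wp(I)\setminus\{\varnothing\}$. A model adds $\pi$ from propositional variables to $\wp(W)$. Given an assignment $g:\mathsf{Var}\to I$: $w\Vdash_gp$ iff $w\in\pi(p)$; $\neg$ is classical negation; $\wedge$ pointwise; $w\Vdash_g\Box_\mathrm{v}\varphi$ iff $\{u\in W\mid u\Vdash_g\varphi\}\in N_{g(\mathrm{v})}(w)$; $w\Vdash_g\forall\mathrm{v}\varphi$ iff $w\Vdash_{g[\mathrm{v}:=i]}\varphi$ for all $i\in\mathrm{G}(w)$; $w\Vdash_gG(\mathrm{v})$ iff $g(\mathrm{v})\in\mathrm{G}(w)$; $w\Vdash_gO(\mathrm{v})$ iff for every $Z\subseteq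 W$, $Z\in N_{g(\mathrm{v})}(w)$ or $W\setminus Z\in N_{g(\mathrm{v})}(w)$. A formula is valid on the frame if it holds at every world, in every model on the frame, under every assignment. -}

module Defs where

open import Data.Nat using (ℕ; _≟_)
open import Data.Bool using (Bool; true; false; not)
open import Data.Product using (Σ; _×_)
open import Data.Sum using (_⊎_)
open import Relation.Nullary using (¬_; yes; no; does)
open import Relation.Binary.PropositionalEquality using (_≡_)
open import Level using (0ℓ)
open import Axiom.ExcludedMiddle using (ExcludedMiddle)

PropVar : Set
PropVar = ℕ

AgVar : Set
AgVar = ℕ

data Form : Set where
  prop  : PropVar → Form
  ¬'_   : Form → Form
  _∧'_  : Form → Form → Form
  □[_]_ : AgVar → Form → Form
  ∀[_]_ : AgVar → Form → Form
  G'    : AgVar → Form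
  O'    : AgVar → Form

_⇒'_ : Form → Form → Form
φ ⇒' ψ = ¬' (φ ∧' (¬' ψ))

∃[_]'_ : AgVar → Form → Form
∃[ v ]' φ = ¬' (∀[ v ] (¬' φ))

Subset : Set → Set
Subset W = W → Bool

_∈_ : {W : Set} → W → Subset W → Set
u ∈ X = X u ≡ true

_⊆_ : {W : Set} → Subset W → Subset W → Set
X ⊆ Y = ∀ u → u ∈ X → u ∈ Y

∁ : {W : Set} → Subset W → Subset W
∁ Z u = not (Z u)

-- N i w is the neighbourhood collection N_i(w) ⊆ ℘(W), given by its
-- characteristic function; G w is the (nonempty) agent domain G(w) ⊆ I.
record Frame (I : Set) : Set₁ where
  field
    W          : Set
    W-nonempty : W
    N          : I → W → Subset W → Bool
    N-mono     : ∀ i w (X Y : Subset W) → X ∈ N i w → X ⊆ Y → Y ∈ N i w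
    G          : W → Subset I
    G-nonempty : ∀ w → Σ I (λ i → i ∈ G w)

-- Semantics, relative to a classical (excluded-middle) metatheory, which is
-- used only to turn the truth set of a formula into an element of ℘(W).
module Semantics (lem : ExcludedMiddle 0ℓ) {I : Set} (F : Frame I) where
  open Frame F

  Valuation : Set
  Valuation = PropVar → Subset W

  Assignment : Set
  Assignment = AgVar → I

  update : Assignment → AgVar → I → Assignment
  update g v i x with x ≟ v
  ... | yes _ = i
  ... | no  _ = g x

  sat : Valuation → Assignment → W → Form → Set
  sat π g w (prop p)   = w ∈ π p
  sat π g w (¬' φ)     = ¬ sat π g w φ
  sat π g w (φ ∧' ψ)   = sat π g w φ × sat π g w ψ
  sat π g w (□[ v ] φ) = (λ u → does (lem {sat π g u φ})) ∈ N (g v) w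
  sat π g w (∀[ v ] φ) = (i : I) → i ∈ G w → sat π (update g v i) w φ
  sat π g w (G' v)     = g v ∈ G w
  sat π g w (O' v)     = (Z : Subset W) → Z ∈ N (g v) w ⊎ ∁ Z ∈ N (g v) w

  Valid : Form → Set
  Valid φ = (π : Valuation) (g : Assignment) (w : W) → sat π g w φ

Valid : ExcludedMiddle 0ℓ → {I : Set} → Frame I → Form → Set
Valid lem F = Semantics.Valid lem F

module Submission where

open import Defs
open import Axiom.ExcludedMiddle using (ExcludedMiddle)
open import Level using (0ℓ)
open import Data.Bool using (true; false)
open import Data.Product using (_,_)
open import Data.Sum using (_⊎_; inj₁; inj₂; map)
open import Relation.Nullary using (does; yes; no)
open import Relation.Nullary.Decidable using (dec-true)
open import Relation.Binary.PropositionalEquality using (_≡_; refl; sym; subst)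

-- Make p true exactly at the evaluation world w.  The axiom then yields an
-- agent i ∈ G(w) whose w-neighbourhoods contain a subset of {w}; by
-- monotonicity, whichever of Z and W ∖ Z contains w is then an
-- i-neighbourhood of w, i.e. O(i) holds at w.

module _ {W : Set} where

  ∈-or-∈∁ : (Z : Subset W) (v : W) → v ∈ Z ⊎ v ∈ ∁ Z
  ∈-or-∈∁ Z v with Z v
  ... | true  = inj₁ refl
  ... | false = inj₂ refl

  ⊆-point⇒⊆ : {X Y : Subset W} {v : W} → (∀ u → u ∈ X → u ≡ v) → v ∈ Y → X ⊆ Y
  ⊆-point⇒⊆ {Y = Y} X⊆v v∈Y u u∈X = subst (_∈ Y) (sym (X⊆v u u∈X)) v∈Y

module _ (lem : ExcludedMiddle 0ℓ) {I : Set} (F : Frame I) where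
  open Frame F
  open Semantics lem F hiding (Valid)

  does-lem⇒ : {P : Set} → does (lem {P}) ≡ true → P
  does-lem⇒ {P} e with lem {P}
  ... | yes p = p
  does-lem⇒ () | no _

  ｛_｝ : W → Subset W
  ｛ w ｝ u = does (lem {u ≡ w})

  Decisive : I → W → Set
  Decisive i w = (Z : Subset W) → Z ∈ N i w ⊎ ∁ Z ∈ N i w

  ⊆-point∈N⇒Decisive : ∀ {i w v} {X : Subset W} →
    (∀ u → u ∈ X → u ≡ v) → X ∈ N i w → Decisive i w
  ⊆-point∈N⇒Decisive {i} {w} {v} {X} X⊆v X∈N Z =
    map (λ v∈Z  → N-mono i w X Z     X∈N (⊆-point⇒⊆ X⊆v v∈Z))
        (λ v∈∁Z → N-mono i w X (∁ Z) X∈N (⊆-point⇒⊆ X⊆v v∈∁Z))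
        (∈-or-∈∁ Z v)

  □-singleton⇒Decisive : ∀ g w → sat (λ _ → ｛ w ｝) g w (□[ 0 ] prop 0) →
    Decisive (g 0) w
  □-singleton⇒Decisive g w = ⊆-point∈N⇒Decisive (λ u e → does-lem⇒ (does-lem⇒ e))

  axiom⇒∃O : Valid lem F (prop 0 ⇒' (∃[ 0 ]' (□[ 0 ] prop 0))) →
             Valid lem F (∃[ 0 ]' (O' 0))
  axiom⇒∃O valid π g w no-decisive =
    valid (λ _ → ｛ w ｝) g w
      (dec-true lem refl , λ no-□ → no-□ λ i i∈G □i →
        no-decisive i i∈G (□-singleton⇒Decisive (update g 0 i) w □i))

proposition5p3p42 : (lem : ExcludedMiddle 0ℓ) → (I : Set) → I → (F : Frame I) →
    Valid lem F (prop 0 ⇒' (∃[ 0 ]' (□[ 0 ] prop 0))) →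
    Valid lem F (∃[ 0 ]' (O' 0))
proposition5p3p42 lem I _ F = axiom⇒∃O lem F
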